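{- For all $n\ge 2$, $\overline{q}_n(312,321)=4\cdot 3^{n-2}$.
   Context: For a positive integer $n$, let $\mathcal{S}_{n,n}$ denote the set of all permutations (words) $\pi=\pi_1\cdots\pi_{2n}$ of the multiset $\{1,1,2,2,\ldots,n,n\}$. A word $\pi$ contains a pattern $\sigma=\sigma_1\cdots\sigma_k$ if there are indices $i_1<\cdots<i_k$ such that $\pi_{i_a}=\pi_{i_b}$ iff $\sigma_a=\sigma_b$ and $\pi_{i_a}<\pi_{i_b}$ iff $\sigma_a<\sigma_b$ for all $a,b$; otherwise $\pi$ avoids $\sigma$. The quasi-Stirling permutations $\overline{\mathcal{Q}}_n$ are the $\pi\in\mathcal{S}_{n,n}$ avoiding both $1212$ and $2121$. For a set $\Lambda$ of patterns, $\overline{\mathcal{Q}}_n(\Lambda)$ is the set of $\pi\in\overline{\mathcal{Q}}_n$ avoiding every pattern in $\Lambda$, and $\overline{q}_n(\Lambda)=|\overline{\mathcal{Q}}_n(\Lambda)|$. -}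

module Defs where

open import Data.Nat using (ℕ; zero; suc; _<_; _*_; _^_; _∸_; _≤_)
open import Data.List using (List; []; _∷_; _++_; zip; length)
open import Data.List.Relation.Unary.All using (All)
open import Data.List.Relation.Unary.Unique.Propositional using (Unique)
open import Data.List.Membership.Propositional using (_∈_)
open import Data.List.Relation.Binary.Permutation.Propositional using (_↭_)
open import Data.List.Relation.Binary.Sublist.Propositional using (_⊆_)
open import Data.Product using (Σ; _×_; ∃; _,_)
open import Data.Unit using (⊤)
open import Data.Empty using (⊥)
open import Relation.Nullary using (¬_)
open import Relation.Binary.PropositionalEquality using (_≡_)
open import Function.Bundles using (_⇔_)

doubled : ℕ → List ℕ
doubled zero = []
doubled (suc n) = doubled n ++ (suc n ∷ suc n ∷ [])

InS : ℕ → List ℕ → Set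
InS n π = π ↭ doubled n

SameRel : ℕ → ℕ → ℕ → ℕ → Set
SameRel x x' y y' = ((x ≡ x') ⇔ (y ≡ y')) × ((x < x') ⇔ (y < y')) × ((x' < x) ⇔ (y' < y))

OrderIso : List ℕ → List ℕ → Set
OrderIso [] [] = ⊤
OrderIso [] (_ ∷ _) = ⊥
OrderIso (_ ∷ _) [] = ⊥
OrderIso (x ∷ u) (y ∷ v) =
  All (λ p → SameRel x (Data.Product.proj₁ p) y (Data.Product.proj₂ p)) (zip u v)
  × OrderIso u v

Contains : List ℕ → List ℕ → Set
Contains π σ = ∃ λ s → (s ⊆ π) × OrderIso s σ

Avoids : List ℕ → List ℕ → Set
Avoids π σ = ¬ Contains π σ

p1212 p2121 p312 p321 : List ℕ
p1212 = 1 ∷ 2 ∷ 1 ∷ 2 ∷ []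
p2121 = 2 ∷ 1 ∷ 2 ∷ 1 ∷ []
p312 = 3 ∷ 1 ∷ 2 ∷ []
p321 = 3 ∷ 2 ∷ 1 ∷ []

QuasiStirling : ℕ → List ℕ → Set
QuasiStirling n π = InS n π × Avoids π p1212 × Avoids π p2121

Q312-321 : ℕ → List ℕ → Set
Q312-321 n π = QuasiStirling n π × Avoids π p312 × Avoids π p321

HasCard : (List ℕ → Set) → ℕ → Set
HasCard P k = Σ (List (List ℕ)) λ ws →
  Unique ws × (∀ w → (w ∈ ws) ⇔ P w) × (length ws ≡ k)

-- Reversing π turns avoidance of 312 and 321 into the condition that no letter is
-- preceded by two distinct smaller letters, and swaps 1212 with 2121. In such a reversed
-- word the letters before the second copy of the largest letter m are copies of m and of
-- a single letter y, so erasing m leaves a word ρ of the same kind and the word is m m ρ,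
-- or y m m ρ′ where ρ = y ρ′, or, when ρ = y y ρ′, also m y y m ρ′ or y y m m ρ′;
-- conversely each of these insertions keeps the patterns out. Weighting a word by 2 if it
-- starts with a repeated letter and by 1 otherwise, a nonempty word of weight k has 2k
-- insertions of total weight 3k, so the total weight triples at each step and there are
-- 2 · 2 · 3^(n-2) words of length 2n.

module Submission where

open import Defs
open import Data.Nat using (ℕ; zero; suc; _+_; _*_; _^_; _∸_; _≤_; _<_; _≟_; s≤s)
open import Data.Nat.Properties
  using (≤-refl; m≤n⇒m≤1+n; <⇒≢; >⇒≢; <⇒≱; ≤∧≢⇒<; <-irrefl; <-asym; <-trans; <-cmp; n<1+n;
         suc-injective; *-assoc; *-comm; *-zeroʳ; *-distribˡ-+)
open import Data.List using (List; []; _∷_; _++_; length; reverse; map; concatMap; filter)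
open import Data.Nat.ListAction using (sum)
open import Data.Nat.ListAction.Properties using (sum-++)
open import Data.List.Properties
  using (filter-accept; filter-reject; filter-none; filter-some; length-++; map-++;
         length-map; ++-assoc; ∷-injectiveˡ; ∷-injectiveʳ; reverse-involutive; reverse-injective)
open import Data.List.Membership.Propositional using (_∈_; _∉_; find; lose)
open import Data.List.Membership.Propositional.Properties
  using (∈-++⁺ʳ; ∈-concatMap⁺; ∈-concatMap⁻; ∈-map⁺; ∈-map⁻)
open import Data.List.Relation.Unary.Any using (here; there; any?)
open import Data.List.Relation.Unary.All using (All; []; _∷_)
import Data.List.Relation.Unary.All as All
open import Data.List.Relation.Unary.All.Properties using (¬Any⇒All¬; All¬⇒¬Any)
open import Data.List.Relation.Unary.AllPairs using ([]; _∷_)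
open import Data.List.Relation.Unary.Unique.Propositional using (Unique)
import Data.List.Relation.Unary.Unique.Propositional.Properties as Unique
open import Data.List.Relation.Binary.Permutation.Propositional
  using (_↭_; prep; ↭-refl; ↭-sym; ↭-trans)
open import Data.List.Relation.Binary.Permutation.Propositional.Properties
  using (↭-length; filter-↭; ∈-resp-↭; ↭-empty-inv; ¬x∷xs↭[]; ++-comm; shifts; drop-∷; ↭-reverse)
open import Data.List.Relation.Binary.Sublist.Propositional
  using (_⊆_; []; _∷_; _∷ʳ_; ⊆-refl; ⊆-trans; ⊆-antisym; lookup; minimum)
open import Data.List.Relation.Binary.Sublist.Heterogeneous using (fromAny)
open import Data.List.Relation.Binary.Sublist.Propositional.Properties using (reverse⁺; reverse⁻)
open import Data.Product using (∃-syntax; _×_; _,_; proj₁; proj₂)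
open import Data.Sum using (_⊎_; inj₁; inj₂; [_,_])
open import Data.Unit using (tt)
open import Data.Empty using (⊥-elim)
open import Function using (_∘_; id)
open import Relation.Binary.Definitions using (tri<; tri≈; tri>)
open import Function.Bundles using (_⇔_; mk⇔; Equivalence)
import Function.Properties.Equivalence as ⇔
open import Relation.Nullary using (¬_; yes; no; contradiction)
open import Relation.Binary.PropositionalEquality
  using (_≡_; _≢_; refl; sym; trans; cong; cong₂; subst; ≢-sym; module ≡-Reasoning)

-- Occurrences of a letter

count : ℕ → List ℕ → ℕ
count v = length ∘ filter (v ≟_)

count-here : ∀ v xs → count v (v ∷ xs) ≡ suc (count v xs)
count-here v xs = cong length (filter-accept (v ≟_) refl)

count-there : ∀ {v x} xs → v ≢ x → count v (x ∷ xs) ≡ count v xs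
count-there {v} xs v≢x = cong length (filter-reject (v ≟_) v≢x)

count-drop : ∀ v xs {k} → count v (v ∷ xs) ≡ suc k → count v xs ≡ k
count-drop v xs c = suc-injective (trans (sym (count-here v xs)) c)

count-skip : ∀ {v x k} xs → v ≢ x → count v (x ∷ xs) ≡ k → count v xs ≡ k
count-skip xs v≢x c = trans (sym (count-there xs v≢x)) c

count-↭ : ∀ v {xs ys} → xs ↭ ys → count v xs ≡ count v ys
count-↭ v p = ↭-length (filter-↭ (v ≟_) p)

∉⇒count≡0 : ∀ {v xs} → v ∉ xs → count v xs ≡ 0
∉⇒count≡0 {v} {xs} v∉xs = cong length (filter-none (v ≟_) (¬Any⇒All¬ xs v∉xs))

count≡0⇒∉ : ∀ {v xs} → count v xs ≡ 0 → v ∉ xs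
count≡0⇒∉ {v} c v∈xs = <-irrefl (sym c) (filter-some (v ≟_) v∈xs)

count≡suc⇒∈ : ∀ {v k} xs → count v xs ≡ suc k → v ∈ xs
count≡suc⇒∈ {v} xs c with any? (v ≟_) xs
... | yes v∈xs = v∈xs
... | no v∉xs with () ← trans (sym c) (∉⇒count≡0 v∉xs)

doubled-suc-↭ : ∀ n → doubled (suc n) ↭ suc n ∷ suc n ∷ doubled n
doubled-suc-↭ n = ++-comm (doubled n) (suc n ∷ suc n ∷ [])

∈-doubled⇒≤ : ∀ {v} n → v ∈ doubled n → v ≤ n
∈-doubled⇒≤ (suc n) v∈ with ∈-resp-↭ (doubled-suc-↭ n) v∈
... | here refl = ≤-refl
... | there (here refl) = ≤-refl
... | there (there v∈d) = m≤n⇒m≤1+n (∈-doubled⇒≤ n v∈d)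

∉-doubled : ∀ {v} n → n < v → v ∉ doubled n
∉-doubled n n<v v∈ = <⇒≱ n<v (∈-doubled⇒≤ n v∈)

count-doubled : ∀ {v} n → v ∈ doubled n → count v (doubled n) ≡ 2
count-doubled {v} (suc n) v∈ with v ≟ suc n
... | yes refl = begin
  count v (doubled (suc n))        ≡⟨ count-↭ v (doubled-suc-↭ n) ⟩
  count v (v ∷ v ∷ doubled n)      ≡⟨ count-here v _ ⟩
  suc (count v (v ∷ doubled n))    ≡⟨ cong suc (count-here v _) ⟩
  2 + count v (doubled n)          ≡⟨ cong (2 +_) (∉⇒count≡0 (∉-doubled n ≤-refl)) ⟩
  2                                ∎
  where open ≡-Reasoning
... | no v≢ = begin
  count v (doubled (suc n))           ≡⟨ count-↭ v (doubled-suc-↭ n) ⟩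
  count v (suc n ∷ suc n ∷ doubled n) ≡⟨ count-there _ v≢ ⟩
  count v (suc n ∷ doubled n)         ≡⟨ count-there _ v≢ ⟩
  count v (doubled n)                 ≡⟨ count-doubled n v∈d ⟩
  2                                   ∎
  where
  open ≡-Reasoning
  v∈d : v ∈ doubled n
  v∈d with ∈-resp-↭ (doubled-suc-↭ n) v∈
  ... | here v≡ = contradiction v≡ v≢
  ... | there (here v≡) = contradiction v≡ v≢
  ... | there (there v∈d) = v∈d

module _ (n : ℕ) {ρ : List ℕ} (ρ↭ : ρ ↭ doubled n) where

  ↭-doubled-≤ : ∀ {x} → x ∈ ρ → x ≤ n
  ↭-doubled-≤ = ∈-doubled⇒≤ n ∘ ∈-resp-↭ ρ↭

  ↭-doubled-count : ∀ {x} → x ∈ ρ → count x ρ ≡ 2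
  ↭-doubled-count {x} x∈ρ = trans (count-↭ x ρ↭) (count-doubled n (∈-resp-↭ ρ↭ x∈ρ))

  ↭-doubled-fresh : suc n ∉ ρ
  ↭-doubled-fresh = ∉-doubled n (n<1+n n) ∘ ∈-resp-↭ ρ↭

-- Patterns in the reversed word

Has123or213 : List ℕ → Set
Has123or213 ρ = ∃[ a ] ∃[ b ] ∃[ c ] (a ∷ b ∷ c ∷ []) ⊆ ρ × a ≢ b × a < c × b < c

Has1212or2121 : List ℕ → Set
Has1212or2121 ρ = ∃[ a ] ∃[ b ] (a ∷ b ∷ a ∷ b ∷ []) ⊆ ρ × a ≢ b

Admissible : List ℕ → Set
Admissible ρ = ¬ Has123or213 ρ × ¬ Has1212or2121 ρ

admissible-[] : Admissible []
admissible-[] = (λ { (_ , _ , _ , () , _) }) , (λ { (_ , _ , () , _) })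

admissible-⊆ : ∀ {s w} → s ⊆ w → Admissible w → Admissible s
admissible-⊆ s⊆w (¬h₃ , ¬h₄) =
  (λ (a , b , c , σ , r) → ¬h₃ (a , b , c , ⊆-trans σ s⊆w , r)) ,
  (λ (a , b , σ , r) → ¬h₄ (a , b , ⊆-trans σ s⊆w , r))

module _ {a b c d : ℕ} where

  sameRel-< : a < b → c < d → SameRel a b c d
  sameRel-< a<b c<d =
    mk⇔ (λ a≡b → contradiction a≡b (<⇒≢ a<b)) (λ c≡d → contradiction c≡d (<⇒≢ c<d)) ,
    mk⇔ (λ _ → c<d) (λ _ → a<b) ,
    mk⇔ (λ b<a → ⊥-elim (<-asym a<b b<a)) (λ d<c → ⊥-elim (<-asym c<d d<c))

  sameRel-> : b < a → d < c → SameRel a b c d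
  sameRel-> b<a d<c =
    mk⇔ (λ a≡b → contradiction a≡b (>⇒≢ b<a)) (λ c≡d → contradiction c≡d (>⇒≢ d<c)) ,
    mk⇔ (λ a<b → ⊥-elim (<-asym a<b b<a)) (λ c<d → ⊥-elim (<-asym c<d d<c)) ,
    mk⇔ (λ _ → d<c) (λ _ → b<a)

  sameRel-≡ : a ≡ b → c ≡ d → SameRel a b c d
  sameRel-≡ refl refl = mk⇔ (λ _ → refl) (λ _ → refl) , irrefl , irrefl
    where
    irrefl : ∀ {x y} → (x < x) ⇔ (y < y)
    irrefl = mk⇔ (⊥-elim ∘ <-irrefl refl) (⊥-elim ∘ <-irrefl refl)

  sameRel-≡⁻ : SameRel a b c d → c ≡ d → a ≡ b
  sameRel-≡⁻ r = Equivalence.from (proj₁ r)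

  sameRel->⁻ : SameRel a b c d → d < c → b < a
  sameRel->⁻ r = Equivalence.from (proj₂ (proj₂ r))

private
  1<2 : 1 < 2
  1<2 = n<1+n 1

  2<3 : 2 < 3
  2<3 = n<1+n 2

  1<3 : 1 < 3
  1<3 = <-trans 1<2 2<3

reverse-has123or213 : ∀ {π i j} → i ≢ j → i < 3 → j < 3 →
                      Contains π (3 ∷ i ∷ j ∷ []) → Has123or213 (reverse π)
reverse-has123or213 i≢j i<3 j<3 ((x ∷ y ∷ z ∷ []) , σ , (x~y ∷ x~z ∷ []) , (y~z ∷ []) , _) =
  z , y , x , reverse⁺ σ , (λ z≡y → i≢j (Equivalence.to (proj₁ y~z) (sym z≡y))) ,
  sameRel->⁻ x~z j<3 , sameRel->⁻ x~y i<3
reverse-has123or213 _ _ _ ([] , _ , ())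
reverse-has123or213 _ _ _ ((_ ∷ []) , _ , _ , ())
reverse-has123or213 _ _ _ ((_ ∷ _ ∷ []) , _ , _ , _ , ())
reverse-has123or213 _ _ _ ((_ ∷ _ ∷ _ ∷ _ ∷ _) , _ , _ , _ , _ , ())

reverse-has1212or2121 : ∀ {π i j} → i ≢ j →
                        Contains π (i ∷ j ∷ i ∷ j ∷ []) → Has1212or2121 (reverse π)
reverse-has1212or2121 i≢j ((x ∷ y ∷ z ∷ w ∷ []) , σ , (x~y ∷ x~z ∷ _ ∷ []) , (_ ∷ y~w ∷ []) , _)
  with sameRel-≡⁻ x~z refl | sameRel-≡⁻ y~w refl
... | refl | refl = y , x , reverse⁺ σ , λ y≡x → i≢j (Equivalence.to (proj₁ x~y) (sym y≡x))
reverse-has1212or2121 _ ([] , _ , ())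
reverse-has1212or2121 _ ((_ ∷ []) , _ , _ , ())
reverse-has1212or2121 _ ((_ ∷ _ ∷ []) , _ , _ , _ , ())
reverse-has1212or2121 _ ((_ ∷ _ ∷ _ ∷ []) , _ , _ , _ , _ , ())
reverse-has1212or2121 _ ((_ ∷ _ ∷ _ ∷ _ ∷ _ ∷ _) , _ , _ , _ , _ , _ , ())

has123or213-reverse : ∀ {π} → Has123or213 (reverse π) → Contains π p312 ⊎ Contains π p321
has123or213-reverse {π} (a , b , c , σ , a≢b , a<c , b<c) with <-cmp a b
... | tri< a<b _ _ =
  inj₂ (_ , σ′ , (sameRel-> b<c 2<3 ∷ sameRel-> a<c 1<3 ∷ []) , (sameRel-> a<b 1<2 ∷ []) , [] , tt)
  where σ′ = reverse⁻ {as = c ∷ b ∷ a ∷ []} {bs = π} σ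
... | tri≈ _ a≡b _ = contradiction a≡b a≢b
... | tri> _ _ b<a =
  inj₁ (_ , σ′ , (sameRel-> b<c 1<3 ∷ sameRel-> a<c 2<3 ∷ []) , (sameRel-< b<a 1<2 ∷ []) , [] , tt)
  where σ′ = reverse⁻ {as = c ∷ b ∷ a ∷ []} {bs = π} σ

has1212or2121-reverse : ∀ {π} → Has1212or2121 (reverse π) → Contains π p1212 ⊎ Contains π p2121
has1212or2121-reverse {π} (a , b , σ , a≢b) with <-cmp a b
... | tri< a<b _ _ = inj₂ (_ , σ′ ,
        (sameRel-> a<b 1<2 ∷ sameRel-≡ refl refl ∷ sameRel-> a<b 1<2 ∷ []) ,
        (sameRel-< a<b 1<2 ∷ sameRel-≡ refl refl ∷ []) , (sameRel-> a<b 1<2 ∷ []) , [] , tt)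
  where σ′ = reverse⁻ {as = b ∷ a ∷ b ∷ a ∷ []} {bs = π} σ
... | tri≈ _ a≡b _ = contradiction a≡b a≢b
... | tri> _ _ b<a = inj₁ (_ , σ′ ,
        (sameRel-< b<a 1<2 ∷ sameRel-≡ refl refl ∷ sameRel-< b<a 1<2 ∷ []) ,
        (sameRel-> b<a 1<2 ∷ sameRel-≡ refl refl ∷ []) , (sameRel-< b<a 1<2 ∷ []) , [] , tt)
  where σ′ = reverse⁻ {as = b ∷ a ∷ b ∷ a ∷ []} {bs = π} σ

Q312-321⇔reverse : ∀ n π → Q312-321 n π ⇔ (reverse π ↭ doubled n × Admissible (reverse π))
Q312-321⇔reverse n π = mk⇔
  (λ ((π↭ , ¬1212 , ¬2121) , ¬312 , ¬321) →
    ↭-trans (↭-reverse π) π↭ ,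
    [ ¬312 , ¬321 ] ∘ has123or213-reverse ,
    [ ¬1212 , ¬2121 ] ∘ has1212or2121-reverse)
  (λ (ρ↭ , ¬h₃ , ¬h₄) →
    (↭-trans (↭-sym (↭-reverse π)) ρ↭ ,
     ¬h₄ ∘ reverse-has1212or2121 (λ ()) , ¬h₄ ∘ reverse-has1212or2121 (λ ())) ,
    ¬h₃ ∘ reverse-has123or213 (λ ()) 1<3 2<3 , ¬h₃ ∘ reverse-has123or213 (λ ()) 2<3 1<3)

⊆-drop : ∀ {x : ℕ} {s} p {t} → x ∉ s → s ⊆ p ++ x ∷ t → s ⊆ p ++ t
⊆-drop [] _ (_ ∷ʳ σ) = σ
⊆-drop [] x∉s (refl ∷ σ) = contradiction (here refl) x∉s
⊆-drop (z ∷ p) x∉s (.z ∷ʳ σ) = z ∷ʳ ⊆-drop p x∉s σ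
⊆-drop (z ∷ p) x∉s (refl ∷ σ) = refl ∷ ⊆-drop p (x∉s ∘ there) σ

⊆-after : ∀ {x : ℕ} {s} q {t} → x ∉ q → (x ∷ s) ⊆ q ++ x ∷ t → s ⊆ t
⊆-after [] _ (x ∷ʳ σ) = ⊆-trans (x ∷ʳ ⊆-refl) σ
⊆-after [] _ (refl ∷ σ) = σ
⊆-after (z ∷ q) x∉q (.z ∷ʳ σ) = ⊆-after q (x∉q ∘ there) σ
⊆-after (z ∷ q) x∉q (refl ∷ σ) = contradiction (here refl) x∉q

⊆-before : ∀ {x : ℕ} s q {t} → x ∉ t → (s ++ x ∷ []) ⊆ q ++ x ∷ t → s ⊆ q
⊆-before [] q _ _ = minimum q
⊆-before (a ∷ s) [] x∉t (_ ∷ʳ σ) = contradiction (lookup σ (there (∈-++⁺ʳ s (here refl)))) x∉t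
⊆-before (a ∷ s) [] x∉t (refl ∷ σ) = contradiction (lookup σ (∈-++⁺ʳ s (here refl))) x∉t
⊆-before (a ∷ s) (z ∷ q) x∉t (.z ∷ʳ σ) = z ∷ʳ ⊆-before (a ∷ s) q x∉t σ
⊆-before (a ∷ s) (z ∷ q) x∉t (refl ∷ σ) = refl ∷ ⊆-before s q x∉t σ

-- Inserting the largest letter

data Insertion (m : ℕ) : List ℕ → List ℕ → Set where
  atFront    : ∀ ρ   → Insertion m ρ (m ∷ m ∷ ρ)
  afterFirst : ∀ y t → Insertion m (y ∷ t) (y ∷ m ∷ m ∷ t)
  aroundPair : ∀ y t → Insertion m (y ∷ y ∷ t) (m ∷ y ∷ y ∷ m ∷ t)
  afterPair  : ∀ y t → Insertion m (y ∷ y ∷ t) (y ∷ y ∷ m ∷ m ∷ t)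

module _ {m : ℕ} {ρ w : List ℕ} where

  Insertion-↭ : Insertion m ρ w → w ↭ m ∷ m ∷ ρ
  Insertion-↭ (atFront ρ)      = ↭-refl
  Insertion-↭ (afterFirst y t) = shifts (y ∷ []) (m ∷ m ∷ [])
  Insertion-↭ (aroundPair y t) = prep m (shifts (y ∷ y ∷ []) (m ∷ []))
  Insertion-↭ (afterPair y t)  = shifts (y ∷ y ∷ []) (m ∷ m ∷ [])

  Insertion-⊆ : Insertion m ρ w → ρ ⊆ w
  Insertion-⊆ (atFront ρ)      = m ∷ʳ m ∷ʳ ⊆-refl
  Insertion-⊆ (afterFirst y t) = refl ∷ m ∷ʳ m ∷ʳ ⊆-refl
  Insertion-⊆ (aroundPair y t) = m ∷ʳ refl ∷ refl ∷ m ∷ʳ ⊆-refl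
  Insertion-⊆ (afterPair y t)  = refl ∷ refl ∷ m ∷ʳ m ∷ʳ ⊆-refl

  Insertion-restrict : ∀ {s} → Insertion m ρ w → m ∉ s → s ⊆ w → s ⊆ ρ
  Insertion-restrict (atFront ρ)      m∉s = ⊆-drop [] m∉s ∘ ⊆-drop [] m∉s
  Insertion-restrict (afterFirst y t) m∉s = ⊆-drop (y ∷ []) m∉s ∘ ⊆-drop (y ∷ []) m∉s
  Insertion-restrict (aroundPair y t) m∉s = ⊆-drop (y ∷ y ∷ []) m∉s ∘ ⊆-drop [] m∉s
  Insertion-restrict (afterPair y t)  m∉s = ⊆-drop (y ∷ y ∷ []) m∉s ∘ ⊆-drop (y ∷ y ∷ []) m∉s

Insertion-injective : ∀ {m ρ ρ′ w} → m ∉ ρ → m ∉ ρ′ →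
                      Insertion m ρ w → Insertion m ρ′ w → ρ ≡ ρ′
Insertion-injective m∉ρ m∉ρ′ ins ins′ =
  ⊆-antisym (Insertion-restrict ins′ m∉ρ (Insertion-⊆ ins))
            (Insertion-restrict ins m∉ρ′ (Insertion-⊆ ins′))

noPairBeforeLast : ∀ {m y a b} q {t} → All (λ z → z ≡ y ⊎ z ≡ m) q → m ∉ t →
                   a ≢ b → a ≢ m → b ≢ m → ¬ (a ∷ b ∷ m ∷ []) ⊆ q ++ m ∷ t
noPairBeforeLast {m} {y} q q∈ym m∉t a≢b a≢m b≢m σ =
  a≢b (trans (isY (lookup ab⊆q (here refl)) a≢m) (sym (isY (lookup ab⊆q (there (here refl))) b≢m)))
  where
  ab⊆q = ⊆-before (_ ∷ _ ∷ []) q m∉t σ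
  isY : ∀ {z} → z ∈ q → z ≢ m → z ≡ y
  isY z∈q z≢m = [ id , (λ z≡m → contradiction z≡m z≢m) ] (All.lookup q∈ym z∈q)

maxPair-noLetterBetween : ∀ {m c} p {t} → m ∉ p → m ∉ t → ¬ (m ∷ c ∷ m ∷ []) ⊆ p ++ m ∷ m ∷ t
maxPair-noLetterBetween {m} p {t} m∉p m∉t σ with ⊆-after p m∉p (⊆-before (m ∷ _ ∷ []) (p ++ m ∷ []) m∉t σ′)
  where σ′ = subst (_ ⊆_) (sym (++-assoc p (m ∷ []) (m ∷ t))) σ
... | ()

maxPair-noAlternation : ∀ {m c} p {t} → m ∉ p → m ∉ t →
                        ¬ (m ∷ c ∷ m ∷ c ∷ []) ⊆ p ++ m ∷ m ∷ t ×
                        ¬ (c ∷ m ∷ c ∷ m ∷ []) ⊆ p ++ m ∷ m ∷ t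
maxPair-noAlternation {c = c} p m∉p m∉t =
  maxPair-noLetterBetween p m∉p m∉t ∘ ⊆-trans (refl ∷ refl ∷ refl ∷ c ∷ʳ []) ,
  maxPair-noLetterBetween p m∉p m∉t ∘ ⊆-trans (c ∷ʳ refl ∷ refl ∷ refl ∷ [])

private
  ∉-yy : ∀ {m y : ℕ} → m ≢ y → m ∉ y ∷ y ∷ []
  ∉-yy m≢y (here m≡y) = m≢y m≡y
  ∉-yy m≢y (there (here m≡y)) = m≢y m≡y

aroundPair-noMcMc : ∀ {m y c t} → m ≢ y → m ∉ t → y ∉ t →
                    ¬ (m ∷ c ∷ m ∷ c ∷ []) ⊆ m ∷ y ∷ y ∷ m ∷ t
aroundPair-noMcMc {m} {y} {c} m≢y m∉t y∉t (_ ∷ʳ σ) = ∉-yy m≢y (lookup mc⊆yy (here refl))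
  where mc⊆yy = ⊆-before (m ∷ c ∷ []) (y ∷ y ∷ []) m∉t (⊆-trans (refl ∷ refl ∷ refl ∷ c ∷ʳ []) σ)
aroundPair-noMcMc {m} {y} {c} m≢y m∉t y∉t (refl ∷ σ) = y∉t (subst (_∈ _) (∈-yy c∈between) c∈after)
  where
  c∈between = lookup (⊆-before (c ∷ []) (y ∷ y ∷ []) m∉t (⊆-trans (refl ∷ refl ∷ c ∷ʳ []) σ)) (here refl)
  c∈after = lookup (⊆-after (y ∷ y ∷ []) (∉-yy m≢y) (⊆-trans (c ∷ʳ refl ∷ refl ∷ []) σ)) (here refl)
  ∈-yy : c ∈ y ∷ y ∷ [] → c ≡ y
  ∈-yy (here c≡y) = c≡y
  ∈-yy (there (here c≡y)) = c≡y

aroundPair-noCmCm : ∀ {m y c t} → c ≢ m → m ≢ y → m ∉ t →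
                    ¬ (c ∷ m ∷ c ∷ m ∷ []) ⊆ m ∷ y ∷ y ∷ m ∷ t
aroundPair-noCmCm {m} {y} {c} c≢m m≢y m∉t σ with ⊆-before (c ∷ m ∷ c ∷ []) (m ∷ y ∷ y ∷ []) m∉t σ
... | _ ∷ʳ τ = ∉-yy m≢y (lookup τ (there (here refl)))
... | c≡m ∷ _ = c≢m c≡m

module _ {m : ℕ} {ρ w : List ℕ} (m∉ρ : m ∉ ρ) where

  Insertion-noPairBeforeMax : ∀ {a b} → Insertion m ρ w → a ≢ b → a ≢ m → b ≢ m →
                              ¬ (a ∷ b ∷ m ∷ []) ⊆ w
  Insertion-noPairBeforeMax (atFront ρ) =
    noPairBeforeLast {y = m} (m ∷ []) (inj₂ refl ∷ []) m∉ρ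
  Insertion-noPairBeforeMax (afterFirst y t) =
    noPairBeforeLast (y ∷ m ∷ []) (inj₁ refl ∷ inj₂ refl ∷ []) (m∉ρ ∘ there)
  Insertion-noPairBeforeMax (aroundPair y t) =
    noPairBeforeLast (m ∷ y ∷ y ∷ []) (inj₂ refl ∷ inj₁ refl ∷ inj₁ refl ∷ []) (m∉ρ ∘ there ∘ there)
  Insertion-noPairBeforeMax (afterPair y t) =
    noPairBeforeLast (y ∷ y ∷ m ∷ []) (inj₁ refl ∷ inj₁ refl ∷ inj₂ refl ∷ []) (m∉ρ ∘ there ∘ there)

  Insertion-noAlternationWithMax : ∀ {c} → (∀ {x} → x ∈ ρ → count x ρ ≡ 2) → Insertion m ρ w → c ≢ m →
                                   ¬ (m ∷ c ∷ m ∷ c ∷ []) ⊆ w × ¬ (c ∷ m ∷ c ∷ m ∷ []) ⊆ w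
  Insertion-noAlternationWithMax _ (atFront ρ) _ =
    maxPair-noAlternation [] (λ ()) m∉ρ
  Insertion-noAlternationWithMax _ (afterFirst y t) _ =
    maxPair-noAlternation (y ∷ []) (λ { (here m≡y) → m∉ρ (here m≡y) }) (m∉ρ ∘ there)
  Insertion-noAlternationWithMax _ (afterPair y t) _ =
    maxPair-noAlternation (y ∷ y ∷ []) (∉-yy (m∉ρ ∘ here)) (m∉ρ ∘ there ∘ there)
  Insertion-noAlternationWithMax twice (aroundPair y t) c≢m =
    aroundPair-noMcMc (m∉ρ ∘ here) (m∉ρ ∘ there ∘ there) y∉t ,
    aroundPair-noCmCm c≢m (m∉ρ ∘ here) (m∉ρ ∘ there ∘ there)
    where y∉t = count≡0⇒∉ (count-drop y t (count-drop y (y ∷ t) (twice (here refl))))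

Insertion-admissible : ∀ {m ρ w} → (∀ {x} → x ∈ ρ → x < m) → (∀ {x} → x ∈ ρ → count x ρ ≡ 2) →
                       Admissible ρ → Insertion m ρ w → Admissible w
Insertion-admissible {m} {ρ} {w} below twice (¬h₃ , ¬h₄) ins = ¬h₃′ , ¬h₄′
  where
  m∉ρ : m ∉ ρ
  m∉ρ m∈ρ = <-irrefl refl (below m∈ρ)

  belowMax : ∀ {x} → x ∈ w → x ≢ m → x < m
  belowMax x∈w x≢m with ∈-resp-↭ (Insertion-↭ ins) x∈w
  ... | here x≡m = contradiction x≡m x≢m
  ... | there (here x≡m) = contradiction x≡m x≢m
  ... | there (there x∈ρ) = below x∈ρ

  ¬h₃′ : ¬ Has123or213 w
  ¬h₃′ (a , b , c , σ , a≢b , a<c , b<c) with c ≟ m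
  ... | yes refl = Insertion-noPairBeforeMax m∉ρ ins a≢b (<⇒≢ a<c) (<⇒≢ b<c) σ
  ... | no c≢m = ¬h₃ (a , b , c , Insertion-restrict ins m∉abc σ , a≢b , a<c , b<c)
    where
    c<m = belowMax (lookup σ (there (there (here refl)))) c≢m
    m∉abc = All¬⇒¬Any (>⇒≢ (<-trans a<c c<m) ∷ >⇒≢ (<-trans b<c c<m) ∷ >⇒≢ c<m ∷ [])

  ¬h₄′ : ¬ Has1212or2121 w
  ¬h₄′ (a , b , σ , a≢b) with a ≟ m | b ≟ m
  ... | yes refl | _ = proj₁ (Insertion-noAlternationWithMax m∉ρ twice ins (≢-sym a≢b)) σ
  ... | no a≢m | yes refl = proj₂ (Insertion-noAlternationWithMax m∉ρ twice ins a≢m) σ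
  ... | no a≢m | no b≢m = ¬h₄ (a , b , Insertion-restrict ins m∉abab σ , a≢b)
    where m∉abab = All¬⇒¬Any (≢-sym a≢m ∷ ≢-sym b≢m ∷ ≢-sym a≢m ∷ ≢-sym b≢m ∷ [])

-- Decomposing an admissible word

module _ {m x : ℕ} (x<m : x < m) where

  private
    x≢m : x ≢ m
    x≢m = <⇒≢ x<m

  maxLater : ∀ {c r k} → c ≢ m → count m (c ∷ r) ≡ suc k → (m ∷ []) ⊆ r
  maxLater c≢m cm = fromAny (count≡suc⇒∈ _ (count-skip _ (≢-sym c≢m) cm))

  repeatForced : ∀ {c w} → Admissible w → c < m → (x ∷ c ∷ m ∷ []) ⊆ w → c ≡ x
  repeatForced {c} adm c<m σ with c ≟ x
  ... | yes c≡x = c≡x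
  ... | no c≢x = contradiction (x , c , m , σ , ≢-sym c≢x , x<m , c<m) (proj₁ adm)

  decompose-xxm : ∀ {r} → Admissible (x ∷ x ∷ m ∷ r) → All (_≤ m) r → count m r ≡ 1 → x ∉ r →
                  ∃[ ρ ] Insertion m ρ (x ∷ x ∷ m ∷ r)
  decompose-xxm {d ∷ r} adm (d≤m ∷ _) cm x∉r with d ≟ m
  ... | yes refl = x ∷ x ∷ r , afterPair x r
  ... | no d≢m = contradiction (here (sym d≡x)) x∉r
    where
    d≡x = repeatForced adm (≤∧≢⇒< d≤m d≢m) (refl ∷ x ∷ʳ m ∷ʳ refl ∷ maxLater d≢m cm)

  decompose-xx : ∀ {r} → Admissible (x ∷ x ∷ r) → All (_≤ m) r → count m r ≡ 2 → x ∉ r →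
                 ∃[ ρ ] Insertion m ρ (x ∷ x ∷ r)
  decompose-xx {c ∷ r} adm (c≤m ∷ r≤m) cm x∉r with c ≟ m
  ... | yes refl = decompose-xxm adm r≤m (count-drop m r cm) (x∉r ∘ there)
  ... | no c≢m = contradiction (here (sym c≡x)) x∉r
    where
    c≡x = repeatForced adm (≤∧≢⇒< c≤m c≢m) (refl ∷ x ∷ʳ refl ∷ maxLater c≢m cm)

  decompose-xm : ∀ {r} → Admissible (x ∷ m ∷ r) → All (_≤ m) r → count m r ≡ 1 → count x r ≡ 1 →
                 ∃[ ρ ] Insertion m ρ (x ∷ m ∷ r)
  decompose-xm {c ∷ r} adm (c≤m ∷ _) cm cx with c ≟ m
  ... | yes refl = x ∷ r , afterFirst x r
  ... | no c≢m = contradiction (x , m , refl ∷ refl ∷ sym c≡x ∷ maxLater c≢m cm , x≢m) (proj₂ adm)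
    where
    c≡x = repeatForced adm (≤∧≢⇒< c≤m c≢m) (refl ∷ m ∷ʳ refl ∷ maxLater c≢m cm)

  decompose-x : ∀ {r} → Admissible (x ∷ r) → All (_≤ m) r → count m r ≡ 2 → count x r ≡ 1 →
                ∃[ ρ ] Insertion m ρ (x ∷ r)
  decompose-x {c ∷ r} adm (c≤m ∷ r≤m) cm cx with c ≟ m
  ... | yes refl = decompose-xm adm r≤m (count-drop m r cm) (count-skip r x≢m cx)
  ... | no c≢m with repeatForced adm (≤∧≢⇒< c≤m c≢m) (refl ∷ refl ∷ maxLater c≢m cm)
  ...   | refl = decompose-xx adm r≤m (count-skip r (≢-sym c≢m) cm) (count≡0⇒∉ (count-drop x r cx))

  decompose-mxx : ∀ {r} → Admissible (m ∷ x ∷ x ∷ r) → All (_≤ m) r → count m r ≡ 1 → x ∉ r →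
                  ∃[ ρ ] Insertion m ρ (m ∷ x ∷ x ∷ r)
  decompose-mxx {d ∷ r} adm (d≤m ∷ _) cm x∉r with d ≟ m
  ... | yes refl = x ∷ x ∷ r , aroundPair x r
  ... | no d≢m = contradiction (here (sym d≡x)) x∉r
    where
    d≡x = repeatForced adm (≤∧≢⇒< d≤m d≢m) (m ∷ʳ refl ∷ x ∷ʳ refl ∷ maxLater d≢m cm)

  decompose-mx : ∀ {r} → Admissible (m ∷ x ∷ r) → All (_≤ m) r → count m r ≡ 1 → count x r ≡ 1 →
                 ∃[ ρ ] Insertion m ρ (m ∷ x ∷ r)
  decompose-mx {c ∷ r} adm (c≤m ∷ r≤m) cm cx with c ≟ m
  ... | yes refl = contradiction (m , x , refl ∷ refl ∷ refl ∷ fromAny x∈r , ≢-sym x≢m) (proj₂ adm)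
    where x∈r = count≡suc⇒∈ r (count-skip r x≢m cx)
  ... | no c≢m with repeatForced adm (≤∧≢⇒< c≤m c≢m) (m ∷ʳ refl ∷ refl ∷ maxLater c≢m cm)
  ...   | refl = decompose-mxx adm r≤m (count-skip r (≢-sym c≢m) cm) (count≡0⇒∉ (count-drop x r cx))

decompose : ∀ {m} w → Admissible w → All (_≤ m) w → (∀ {v} → v ∈ w → count v w ≡ 2) → m ∈ w →
            ∃[ ρ ] Insertion m ρ w
decompose {m} (a ∷ r) adm (a≤m ∷ r≤m) twice m∈w with a ≟ m
decompose {m} (a ∷ r) adm (a≤m ∷ r≤m) twice m∈w | no a≢m =
  decompose-x (≤∧≢⇒< a≤m a≢m) adm r≤m
    (count-skip r (≢-sym a≢m) (twice m∈w)) (count-drop a r (twice (here refl)))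
decompose {m} (.m ∷ []) _ _ twice m∈w | yes refl with () ← count-drop m [] (twice m∈w)
decompose {m} (.m ∷ b ∷ r) adm (_ ∷ b≤m ∷ r≤m) twice m∈w | yes refl with b ≟ m
... | yes refl = r , atFront r
... | no b≢m = decompose-mx (≤∧≢⇒< b≤m b≢m) adm r≤m
                 (count-skip r (≢-sym b≢m) (count-drop m (b ∷ r) (twice m∈w)))
                 (count-drop b r (count-skip (b ∷ r) b≢m (twice (there (here refl)))))

-- Generating and counting the words

insertions : ℕ → List ℕ → List (List ℕ)
insertions m [] = (m ∷ m ∷ []) ∷ []
insertions m (y ∷ []) = (m ∷ m ∷ y ∷ []) ∷ (y ∷ m ∷ m ∷ []) ∷ []
insertions m (y ∷ z ∷ t) with y ≟ z
... | yes refl =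
  (m ∷ m ∷ y ∷ y ∷ t) ∷ (y ∷ m ∷ m ∷ y ∷ t) ∷ (m ∷ y ∷ y ∷ m ∷ t) ∷ (y ∷ y ∷ m ∷ m ∷ t) ∷ []
... | no _     = (m ∷ m ∷ y ∷ z ∷ t) ∷ (y ∷ m ∷ m ∷ z ∷ t) ∷ []

∈-insertions⁻ : ∀ {m} ρ {w} → w ∈ insertions m ρ → Insertion m ρ w
∈-insertions⁻ [] (here refl) = atFront []
∈-insertions⁻ (y ∷ []) (here refl) = atFront _
∈-insertions⁻ (y ∷ []) (there (here refl)) = afterFirst y []
∈-insertions⁻ (y ∷ z ∷ t) w∈ with y ≟ z
∈-insertions⁻ (y ∷ _ ∷ t) (here refl) | yes refl = atFront _
∈-insertions⁻ (y ∷ _ ∷ t) (there (here refl)) | yes refl = afterFirst y _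
∈-insertions⁻ (y ∷ _ ∷ t) (there (there (here refl))) | yes refl = aroundPair y t
∈-insertions⁻ (y ∷ _ ∷ t) (there (there (there (here refl)))) | yes refl = afterPair y t
∈-insertions⁻ (y ∷ z ∷ t) (here refl) | no _ = atFront _
∈-insertions⁻ (y ∷ z ∷ t) (there (here refl)) | no _ = afterFirst y _

∈-insertions⁺ : ∀ {m ρ w} → Insertion m ρ w → w ∈ insertions m ρ
∈-insertions⁺ (atFront []) = here refl
∈-insertions⁺ (atFront (y ∷ [])) = here refl
∈-insertions⁺ (atFront (y ∷ z ∷ t)) with y ≟ z
... | yes refl = here refl
... | no _ = here refl
∈-insertions⁺ (afterFirst y []) = there (here refl)
∈-insertions⁺ (afterFirst y (z ∷ t)) with y ≟ z
... | yes refl = there (here refl)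
... | no _ = there (here refl)
∈-insertions⁺ (aroundPair y t) with y ≟ y
... | yes refl = there (there (here refl))
... | no y≢y = contradiction refl y≢y
∈-insertions⁺ (afterPair y t) with y ≟ y
... | yes refl = there (there (there (here refl)))
... | no y≢y = contradiction refl y≢y

words : ℕ → List (List ℕ)
words zero = [] ∷ []
words (suc n) = concatMap (insertions (suc n)) (words n)

words-sound : ∀ n {ρ} → ρ ∈ words n → ρ ↭ doubled n × Admissible ρ
words-sound zero (here refl) = ↭-refl , admissible-[]
words-sound (suc n) w∈ with find (∈-concatMap⁻ (insertions (suc n)) {xs = words n} w∈)
... | ρ , ρ∈ , w∈ins with words-sound n ρ∈
...   | ρ↭ , adm =
  ↭-trans (Insertion-↭ ins) (↭-trans (prep _ (prep _ ρ↭)) (↭-sym (doubled-suc-↭ n))) ,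
  Insertion-admissible (s≤s ∘ ↭-doubled-≤ n ρ↭) (↭-doubled-count n ρ↭) adm ins
  where ins = ∈-insertions⁻ ρ w∈ins

words-complete : ∀ n {w} → w ↭ doubled n → Admissible w → w ∈ words n
words-complete zero w↭ _ rewrite ↭-empty-inv w↭ = here refl
words-complete (suc n) {w} w↭ adm
  with decompose w adm (All.tabulate (↭-doubled-≤ (suc n) w↭)) (↭-doubled-count (suc n) w↭)
                 (∈-resp-↭ (↭-sym w↭) (∈-++⁺ʳ (doubled n) (here refl)))
... | ρ , ins = ∈-concatMap⁺ (insertions (suc n)) (lose ρ∈ (∈-insertions⁺ ins))
  where
  ρ↭ : ρ ↭ doubled n
  ρ↭ = drop-∷ (drop-∷ (↭-trans (↭-sym (Insertion-↭ ins)) (↭-trans w↭ (doubled-suc-↭ n))))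
  ρ∈ : ρ ∈ words n
  ρ∈ = words-complete n ρ↭ (admissible-⊆ (Insertion-⊆ ins) adm)

∈-words : ∀ n ρ → ρ ∈ words n ⇔ (ρ ↭ doubled n × Admissible ρ)
∈-words n ρ = mk⇔ (words-sound n) (λ (ρ↭ , adm) → words-complete n ρ↭ adm)

words-fresh : ∀ n {ρ} → ρ ∈ words n → suc n ∉ ρ
words-fresh n = ↭-doubled-fresh n ∘ proj₁ ∘ words-sound n

words-nonempty : ∀ n {ρ} → ρ ∈ words (suc n) → ρ ≢ []
words-nonempty n ρ∈ refl =
  ¬x∷xs↭[] (↭-trans (↭-sym (doubled-suc-↭ n)) (↭-sym (proj₁ (words-sound (suc n) ρ∈))))

insertions-unique : ∀ {m ρ} → m ∉ ρ → Unique (insertions m ρ)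
insertions-unique {ρ = []} _ = [] ∷ []
insertions-unique {ρ = y ∷ []} m∉ρ = (m∉ρ ∘ here ∘ ∷-injectiveˡ ∷ []) ∷ [] ∷ []
insertions-unique {ρ = y ∷ z ∷ t} m∉ρ with y ≟ z
... | yes refl =
  (m≢y ∘ ∷-injectiveˡ ∷ m≢y ∘ ∷-injectiveˡ ∘ ∷-injectiveʳ ∷ m≢y ∘ ∷-injectiveˡ ∷ []) ∷
  (m≢y ∘ sym ∘ ∷-injectiveˡ ∷ m≢y ∘ ∷-injectiveˡ ∘ ∷-injectiveʳ ∷ []) ∷
  (m≢y ∘ ∷-injectiveˡ ∷ []) ∷ [] ∷ []
  where m≢y = m∉ρ ∘ here
... | no _ = (m∉ρ ∘ here ∘ ∷-injectiveˡ ∷ []) ∷ [] ∷ []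

concatMap-unique : ∀ {A B : Set} {f : A → List B} {xs} → Unique xs → (∀ {x} → x ∈ xs → Unique (f x)) →
                   (∀ {x x′ y} → x ∈ xs → x′ ∈ xs → y ∈ f x → y ∈ f x′ → x ≡ x′) →
                   Unique (concatMap f xs)
concatMap-unique {xs = []} _ _ _ = []
concatMap-unique {f = f} {xs = x ∷ xs} (x∉xs ∷ u) fu disjoint =
  Unique.++⁺ (fu (here refl))
             (concatMap-unique u (fu ∘ there) (λ i i′ → disjoint (there i) (there i′))) apart
  where
  apart : ∀ {y} → ¬ (y ∈ f x × y ∈ concatMap f xs)
  apart (y∈fx , y∈rest) with find (∈-concatMap⁻ f y∈rest)
  ... | x′ , x′∈xs , y∈fx′ = All.lookup x∉xs x′∈xs (disjoint (here refl) (there x′∈xs) y∈fx y∈fx′)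

words-unique : ∀ n → Unique (words n)
words-unique zero = [] ∷ []
words-unique (suc n) =
  concatMap-unique (words-unique n) (insertions-unique ∘ words-fresh n)
    (λ ρ∈ ρ′∈ w∈ w∈′ → Insertion-injective (words-fresh n ρ∈) (words-fresh n ρ′∈)
                          (∈-insertions⁻ _ w∈) (∈-insertions⁻ _ w∈′))

weight : List ℕ → ℕ
weight (a ∷ b ∷ _) with a ≟ b
... | yes _ = 2
... | no _ = 1
weight _ = 1

totalWeight : List (List ℕ) → ℕ
totalWeight = sum ∘ map weight

weight-repeat : ∀ a t → weight (a ∷ a ∷ t) ≡ 2
weight-repeat a t with a ≟ a
... | yes _ = refl
... | no a≢a = contradiction refl a≢a

weight-distinct : ∀ {a b} t → a ≢ b → weight (a ∷ b ∷ t) ≡ 1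
weight-distinct {a} {b} t a≢b with a ≟ b
... | yes a≡b = contradiction a≡b a≢b
... | no _ = refl

totalWeight-++ : ∀ ws vs → totalWeight (ws ++ vs) ≡ totalWeight ws + totalWeight vs
totalWeight-++ ws vs = trans (cong sum (map-++ weight ws vs)) (sum-++ (map weight ws) _)

insertions-length : ∀ m y t → length (insertions m (y ∷ t)) ≡ 2 * weight (y ∷ t)
insertions-length m y [] = refl
insertions-length m y (z ∷ t) with y ≟ z
... | yes refl = refl
... | no _ = refl

insertions-weight : ∀ {m y} t → m ≢ y → totalWeight (insertions m (y ∷ t)) ≡ 3 * weight (y ∷ t)
insertions-weight {m} {y} [] m≢y
  rewrite weight-repeat m (y ∷ []) | weight-distinct (m ∷ []) (≢-sym m≢y) = refl
insertions-weight {m} {y} (z ∷ t) m≢y with y ≟ z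
... | yes refl
  rewrite weight-repeat m (y ∷ y ∷ t) | weight-distinct (m ∷ y ∷ t) (≢-sym m≢y)
        | weight-distinct (y ∷ m ∷ t) m≢y | weight-repeat y (m ∷ m ∷ t) = refl
... | no y≢z
  rewrite weight-repeat m (y ∷ z ∷ t) | weight-distinct (m ∷ z ∷ t) (≢-sym m≢y) = refl

concatMap-measure : ∀ {A B : Set} (μ : List B → ℕ) → μ [] ≡ 0 → (∀ bs cs → μ (bs ++ cs) ≡ μ bs + μ cs) →
                    ∀ {f : A → List B} {h : A → ℕ} k xs → (∀ {x} → x ∈ xs → μ (f x) ≡ k * h x) →
                    μ (concatMap f xs) ≡ k * sum (map h xs)
concatMap-measure μ μ-[] μ-++ k [] _ = trans μ-[] (sym (*-zeroʳ k))
concatMap-measure μ μ-[] μ-++ {f} {h} k (x ∷ xs) μ-f = begin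
  μ (f x ++ concatMap f xs)               ≡⟨ μ-++ (f x) _ ⟩
  μ (f x) + μ (concatMap f xs)
    ≡⟨ cong₂ _+_ (μ-f (here refl)) (concatMap-measure μ μ-[] μ-++ k xs (μ-f ∘ there)) ⟩
  k * h x + k * sum (map h xs)            ≡⟨ sym (*-distribˡ-+ k (h x) _) ⟩
  k * sum (map h (x ∷ xs))                ∎
  where open ≡-Reasoning

words-weight : ∀ n → totalWeight (words (suc n)) ≡ 2 * 3 ^ n
words-weight zero = refl
words-weight (suc n) = begin
  totalWeight (concatMap (insertions (suc (suc n))) (words (suc n)))
    ≡⟨ concatMap-measure totalWeight refl totalWeight-++ {h = weight} 3 (words (suc n)) weight-step ⟩
  3 * totalWeight (words (suc n))   ≡⟨ cong (3 *_) (words-weight n) ⟩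
  3 * (2 * 3 ^ n)                   ≡⟨ sym (*-assoc 3 2 (3 ^ n)) ⟩
  3 * 2 * 3 ^ n                     ≡⟨ cong (_* 3 ^ n) (*-comm 3 2) ⟩
  2 * 3 * 3 ^ n                     ≡⟨ *-assoc 2 3 (3 ^ n) ⟩
  2 * 3 ^ suc n                     ∎
  where
  open ≡-Reasoning
  weight-step : ∀ {ρ} → ρ ∈ words (suc n) → totalWeight (insertions (suc (suc n)) ρ) ≡ 3 * weight ρ
  weight-step {[]} ρ∈ = contradiction refl (words-nonempty n ρ∈)
  weight-step {y ∷ t} ρ∈ = insertions-weight t (words-fresh (suc n) ρ∈ ∘ here)

words-length : ∀ n → length (words (suc (suc n))) ≡ 4 * 3 ^ n
words-length n = begin
  length (concatMap (insertions (suc (suc n))) (words (suc n)))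
    ≡⟨ concatMap-measure length refl (λ bs _ → length-++ bs) {h = weight} 2 (words (suc n)) length-step ⟩
  2 * totalWeight (words (suc n))   ≡⟨ cong (2 *_) (words-weight n) ⟩
  2 * (2 * 3 ^ n)                   ≡⟨ sym (*-assoc 2 2 (3 ^ n)) ⟩
  4 * 3 ^ n                         ∎
  where
  open ≡-Reasoning
  length-step : ∀ {ρ} → ρ ∈ words (suc n) → length (insertions (suc (suc n)) ρ) ≡ 2 * weight ρ
  length-step {[]} ρ∈ = contradiction refl (words-nonempty n ρ∈)
  length-step {y ∷ t} _ = insertions-length _ y t

∈-map-reverse : ∀ {A : Set} {π : List A} ws → π ∈ map reverse ws ⇔ reverse π ∈ ws
∈-map-reverse {π = π} ws = mk⇔
  (λ π∈ → let ρ , ρ∈ , π≡ = ∈-map⁻ reverse π∈ in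
          subst (_∈ ws) (trans (sym (reverse-involutive ρ)) (cong reverse (sym π≡))) ρ∈)
  (λ ρ∈ → subst (_∈ map reverse ws) (reverse-involutive π) (∈-map⁺ reverse ρ∈))

theorem4p5 : (n : ℕ) → 2 ≤ n → HasCard (Q312-321 n) (4 * 3 ^ (n ∸ 2))
theorem4p5 (suc zero) (s≤s ())
theorem4p5 (suc (suc n)) _ =
  map reverse (words N) ,
  Unique.map⁺ reverse-injective (words-unique N) ,
  (λ π → ⇔.trans (∈-map-reverse (words N))
           (⇔.trans (∈-words N (reverse π)) (⇔.sym (Q312-321⇔reverse N π)))) ,
  trans (length-map reverse (words N)) (words-length n)
  where N = suc (suc n)
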